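{- Let $\mathcal F$ be an algebraic language with no nullary symbols, $\mathbf I=([m];\mathcal F)$ a finite $\mathcal F$-algebra, $\mathbf A$ an $\mathcal F$-algebra with a surjective homomorphism $\chi\colon\mathbf A\to\mathbf I$, $\mathbf C:=\mathfrak C(\mathbf A,\chi)$, $\alpha:=\ker\chi$. (1) The map $\beta\mapsto\beta^*$ is an isomorphism from the interval $I(0,\alpha)=\{\beta\in\mathrm{Con}(\mathbf A):\beta\le\alpha\}$ onto $\mathrm{Con}(\mathbf C)$. (2) For all $\beta_j\in I(0,\alpha)$ ($j\in J$, $J$ nonempty) and $\beta,\gamma\in I(0,\alpha)$: $(\bigcap_{j}\beta_j)^*=\bigcap_j\beta_j^*$, $(\bigvee_j\beta_j)^*=\bigvee_j\beta_j^*$, and for every $k\ge2$, $\beta\circ_k\gamma=\gamma\circ_k\beta$ iff $\beta^*\circ_k\gamma^*=\gamma^*\circ_k\beta^*$.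
   Context: $[m]=\{1,\dots,m\}$, $m\ge1$, $D^{(i)}=\chi^{ -1}(i)$. $\mathfrak C(\mathbf A,\chi)$ has universe $C=D^{(1)}\times\dots\times D^{(m)}$ (columns $\mathbf c=(c^{(1)},\dots,c^{(m)})$), an $m$-ary operation $d(\mathbf c_1,\dots,\mathbf c_m)=(c_1^{(1)},\dots,c_m^{(m)})$, and for each $k$-ary $f\in\mathcal F$ and $\mathbf i=(i_1,\dots,i_k)\in[m]^k$ a $k$-ary operation $\hat f_{\mathbf i}(\mathbf c_1,\dots,\mathbf c_k)$ obtained from $\mathbf c_1$ by replacing its $f^{\mathbf I}(\mathbf i)$-th entry by $f^{\mathbf A}(c_1^{(i_1)},\dots,c_k^{(i_k)})$. For $\beta\le\alpha$: $\beta^*=\{(\mathbf a,\mathbf b)\in C^2:(a^{(i)},b^{(i)})\in\beta\ \forall i\in[m]\}$. $\beta\circ_k\gamma$ denotes the $k$-fold alternating relational product $\beta\circ\gamma\circ\beta\circ\cdots$ with $k$ factors. -}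

module Defs where

open import Level using (Level; _⊔_) renaming (suc to lsuc)
open import Data.Nat using (ℕ; zero; suc)
open import Data.Fin using (Fin; _≟_)
open import Data.Vec using (Vec; []; _∷_; map; zipWith; lookup)
open import Data.Vec.Relation.Binary.Pointwise.Inductive using (Pointwise)
open import Data.Product using (Σ; ∃; _×_; _,_; proj₁; proj₂)
open import Data.Empty using (⊥-elim)
open import Relation.Nullary using (¬_; yes; no)
open import Relation.Binary.Core using (Rel; _⇒_; _⇔_)
open import Relation.Binary.Structures using (IsEquivalence)
open import Relation.Binary.PropositionalEquality using (_≡_; refl; sym; trans; cong; cong₂)

record Signature (σ : Level) : Set (lsuc σ) where
  field
    Sym   : Set σ
    arity : Sym → ℕ

open Signature public

NoNullary : ∀ {σ} → Signature σ → Set σ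
NoNullary S = ∀ f → ¬ (arity S f ≡ 0)

record Algebra {σ} (S : Signature σ) (a : Level) : Set (σ ⊔ lsuc a) where
  field
    Carrier : Set a
    op      : (f : Sym S) → Vec Carrier (arity S f) → Carrier

open Algebra public

Surjective : ∀ {a b} {X : Set a} {Y : Set b} → (X → Y) → Set (a ⊔ b)
Surjective {X = X} h = ∀ y → Σ X λ x → h x ≡ y

ker : ∀ {a b} {X : Set a} {Y : Set b} → (X → Y) → Rel X b
ker h x y = h x ≡ h y

module _ {σ} {S : Signature σ} where

  IsHom : ∀ {a b} (A : Algebra S a) (B : Algebra S b) → (Carrier A → Carrier B) → Set (σ ⊔ a ⊔ b)
  IsHom A B h = ∀ f (as : Vec (Carrier A) (arity S f)) → h (op A f as) ≡ op B f (map h as)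

  IsCongruence : ∀ {a ℓ} (A : Algebra S a) → Rel (Carrier A) ℓ → Set (σ ⊔ a ⊔ ℓ)
  IsCongruence A θ =
    IsEquivalence θ ×
    (∀ f (as bs : Vec (Carrier A) (arity S f)) → Pointwise θ as bs → θ (op A f as) (op A f bs))


module _ {a} {X : Set a} where

  ⋂ : ∀ {j ℓ} {J : Set j} → (J → Rel X ℓ) → Rel X (j ⊔ ℓ)
  ⋂ Rs x y = ∀ j → Rs j x y

  _∘ᵣ_ : Rel X a → Rel X a → Rel X a
  (R ∘ᵣ Q) x y = ∃ λ z → R x z × Q z y

  -- β ∘_k γ = β ∘ γ ∘ β ∘ ⋯ (k factors), for k ≥ 1
  -- (by convention k = 0 gives β, it is never used)
  ∘[_] : ℕ → Rel X a → Rel X a → Rel X a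
  ∘[ zero ]        β γ = β
  ∘[ suc zero ]    β γ = β
  ∘[ suc (suc k) ] β γ = β ∘ᵣ ∘[ suc k ] γ β

  IsJoinOf : ∀ {j c} {J : Set j} → (Rel X a → Set c) → (J → Rel X a) → Rel X a → Set (lsuc a ⊔ j ⊔ c)
  IsJoinOf IsCon Rs θ =
    IsCon θ × (∀ j → Rs j ⇒ θ) × (∀ γ → IsCon γ → (∀ j → Rs j ⇒ γ) → θ ⇒ γ)

first : ∀ {a} {X : Set a} {n} → ¬ (n ≡ 0) → Vec X n → X
first {n = zero}  ne []      = ⊥-elim (ne refl)
first {n = suc n} ne (x ∷ _) = x

module Construction
  {σ a} {S : Signature σ} (noNull : NoNullary S)
  (A : Algebra S a) (m : ℕ) (opI : (f : Sym S) → Vec (Fin m) (arity S f) → Fin m)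
  (χ : Carrier A → Fin m)
  (χ-hom : ∀ f (as : Vec (Carrier A) (arity S f)) → χ (op A f as) ≡ opI f (map χ as))
  where

  D : Fin m → Set a
  D i = Σ (Carrier A) λ x → χ x ≡ i

  Col : Set a
  Col = (i : Fin m) → D i

  _⟨_⟩ : Col → Fin m → Carrier A
  c ⟨ i ⟩ = proj₁ (c i)

  _≈C_ : Rel Col a
  c ≈C c' = ∀ i → c ⟨ i ⟩ ≡ c' ⟨ i ⟩

  dC : Vec Col m → Col
  dC cs i = lookup cs i i

  private
    diag : ∀ {k} (cs : Vec Col k) (is : Vec (Fin m) k) →
           map χ (zipWith _⟨_⟩ cs is) ≡ is
    diag []       []       = refl
    diag (c ∷ cs) (i ∷ is) = cong₂ _∷_ (proj₂ (c i)) (diag cs is)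

  hat : (f : Sym S) → Vec (Fin m) (arity S f) → Vec Col (arity S f) → Col
  hat f is cs j with j ≟ opI f is
  ... | yes p = op A f (zipWith _⟨_⟩ cs is) ,
                trans (χ-hom f _) (trans (cong (opI f) (diag cs is)) (sym p))
  ... | no _  = first (noNull f) cs j

  IsCongruenceC : Rel Col a → Set (σ ⊔ a)
  IsCongruenceC θ =
    IsEquivalence θ ×
    (_≈C_ ⇒ θ) ×
    (∀ (cs cs' : Vec Col m) → Pointwise θ cs cs' → θ (dC cs) (dC cs')) ×
    (∀ f (is : Vec (Fin m) (arity S f)) (cs cs' : Vec Col (arity S f)) →
       Pointwise θ cs cs' → θ (hat f is cs) (hat f is cs'))

  _* : Rel (Carrier A) a → Rel Col a
  (β *) c c' = ∀ i → β (c ⟨ i ⟩) (c' ⟨ i ⟩)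

  α : Rel (Carrier A) Level.zero
  α = ker χ

  InInterval : Rel (Carrier A) a → Set (σ ⊔ a)
  InInterval β = IsCongruence A β × (β ⇒ α)

FinAlgebra : ∀ {σ} {S : Signature σ} (m : ℕ) →
             ((f : Sym S) → Vec (Fin m) (arity S f) → Fin m) → Algebra S Level.zero
FinAlgebra m opI = record { Carrier = Fin m ; op = opI }

-- A relation β ≤ α = ker χ relates only elements of the same fibre D⁽ⁱ⁾, so
-- β* is β acting independently on each entry of a column; since χ is onto,
-- every element is an entry of some column, and β is recovered from β*.
-- Conversely, a congruence θ of 𝐂 yields β by letting x β y when x and y are
-- the χ(x)-th entries of θ-related columns. The operation d makes this work:
-- it replaces a column by one that is fixed outside a single entry, and it
-- reassembles a column from the diagonal of a vector of columns, so θ is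
-- determined entrywise and β is transitive; the operations f̂_𝐢 apply f to
-- a single entry, which makes β compatible. Meets and relational products
-- are computed entrywise, and joins are preserved by any order isomorphism.
module Submission where

open import Defs
open import Level using (Level)
open import Data.Nat using (ℕ; _≤_; zero; suc)
open import Data.Fin using (Fin; _≟_)
open import Data.Vec using (Vec; []; _∷_; map; zipWith; tabulate)
open import Data.Vec.Properties using (lookup∘tabulate)
open import Data.Vec.Relation.Binary.Pointwise.Inductive as Pointwise using (Pointwise; []; _∷_)
open import Data.Product using (Σ; _×_; _,_; proj₁; proj₂)
open import Data.Empty using (⊥-elim)
open import Relation.Nullary using (yes; no; ¬_)
open import Relation.Binary.Core using (Rel; _⇒_) renaming (_⇔_ to _≐_)
open import Relation.Binary.Definitions using (Reflexive; Transitive)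
open import Relation.Binary.Structures using (IsEquivalence)
open import Relation.Binary.PropositionalEquality
  using (_≡_; refl; sym; trans; cong; cong₂; subst; subst₂)
open import Function.Bundles using (_⇔_; mk⇔)

module _ {a} {X : Set a} where

  ∘ᵣ-congʳ : {R P Q : Rel X a} → P ≐ Q → R ∘ᵣ P ≐ R ∘ᵣ Q
  ∘ᵣ-congʳ (P⇒Q , Q⇒P) = (λ (z , r , p) → z , r , P⇒Q p) , (λ (z , r , q) → z , r , Q⇒P q)

  ≐-sym : {P Q : Rel X a} → P ≐ Q → Q ≐ P
  ≐-sym (P⇒Q , Q⇒P) = Q⇒P , P⇒Q

  ≐-trans : {P Q R : Rel X a} → P ≐ Q → Q ≐ R → P ≐ R
  ≐-trans (P⇒Q , Q⇒P) (Q⇒R , R⇒Q) = (λ r → Q⇒R (P⇒Q r)) , (λ r → Q⇒P (R⇒Q r))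

  ∘[]-refl : ∀ k {R Q : Rel X a} → Reflexive R → Reflexive Q → Reflexive (∘[ k ] R Q)
  ∘[]-refl zero          reflR reflQ = reflR
  ∘[]-refl (suc zero)    reflR reflQ = reflR
  ∘[]-refl (suc (suc k)) reflR reflQ = _ , reflR , ∘[]-refl (suc k) reflQ reflR

  ∘[]-⇒ : ∀ k {ℓ} {R Q : Rel X a} {T : Rel X ℓ} → Transitive T →
          R ⇒ T → Q ⇒ T → ∘[ k ] R Q ⇒ T
  ∘[]-⇒ zero          transT R⇒T Q⇒T r = R⇒T r
  ∘[]-⇒ (suc zero)    transT R⇒T Q⇒T r = R⇒T r
  ∘[]-⇒ (suc (suc k)) transT R⇒T Q⇒T (_ , r , s) =
    transT (R⇒T r) (∘[]-⇒ (suc k) transT Q⇒T R⇒T s)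

Pointwise-first : ∀ {a ℓ} {X : Set a} {R : Rel X ℓ} {n} (ne : ¬ (n ≡ 0))
                  {xs ys : Vec X n} → Pointwise R xs ys → R (first ne xs) (first ne ys)
Pointwise-first ne []      = ⊥-elim (ne refl)
Pointwise-first ne (r ∷ _) = r

module Columns {σ a} {S : Signature σ} (noNull : NoNullary S)
  (A : Algebra S a) (m : ℕ) (opI : (f : Sym S) → Vec (Fin m) (arity S f) → Fin m)
  (χ : Carrier A → Fin m) (χ-hom : IsHom A (FinAlgebra m opI) χ) where

  open Construction noNull A m opI χ χ-hom

  dC-tabulate : ∀ (cs : Fin m → Col) i → dC (tabulate cs) ⟨ i ⟩ ≡ cs i ⟨ i ⟩
  dC-tabulate cs i = cong (λ c → proj₁ (c i)) (lookup∘tabulate cs i)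

  hat-at : ∀ f is cs → hat f is cs ⟨ opI f is ⟩ ≡ op A f (zipWith _⟨_⟩ cs is)
  hat-at f is cs with opI f is ≟ opI f is
  ... | yes _  = refl
  ... | no ≢ = ⊥-elim (≢ refl)

  Pointwise-entries : ∀ {β : Rel (Carrier A) a} {k} (is : Vec (Fin m) k)
                      {cs cs' : Vec Col k} → Pointwise (β *) cs cs' →
                      Pointwise β (zipWith _⟨_⟩ cs is) (zipWith _⟨_⟩ cs' is)
  Pointwise-entries []       []        = []
  Pointwise-entries (i ∷ is) (r ∷ rs) = r i ∷ Pointwise-entries is rs

  *-mono : {R Q : Rel (Carrier A) a} → R ⇒ Q → (R *) ⇒ (Q *)
  *-mono R⇒Q r i = R⇒Q (r i)

  *-cong : {R Q : Rel (Carrier A) a} → R ≐ Q → (R *) ≐ (Q *)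
  *-cong {R} {Q} (R⇒Q , Q⇒R) =
    (λ {c} {c'} → *-mono {R} {Q} R⇒Q {c} {c'}) , (λ {c} {c'} → *-mono {Q} {R} Q⇒R {c} {c'})

  *-⋂ : ∀ {J : Set a} (βs : J → Rel (Carrier A) a) → (⋂ βs) * ≐ ⋂ (λ j → βs j *)
  *-⋂ βs = (λ r j i → r i j) , (λ r i j → r j i)

  *-isCongruenceC : {β : Rel (Carrier A) a} → IsCongruence A β → IsCongruenceC (β *)
  *-isCongruenceC {β} (isEq , compatible) =
    isEq* , (λ {c} {c'} → ≈C⇒β* {c} {c'}) , d-compatible , hat-compatible
    where
    module β = IsEquivalence isEq
    isEq* : IsEquivalence (β *)
    isEq* = record
      { refl = λ i → β.refl ; sym = λ r i → β.sym (r i) ; trans = λ r s i → β.trans (r i) (s i) }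
    ≈C⇒β* : _≈C_ ⇒ (β *)
    ≈C⇒β* c≈c' i = subst (β _) (c≈c' i) β.refl
    d-compatible : ∀ cs cs' → Pointwise (β *) cs cs' → (β *) (dC cs) (dC cs')
    d-compatible _ _ rs i = Pointwise.lookup rs i i
    hat-compatible : ∀ f is cs cs' → Pointwise (β *) cs cs' → (β *) (hat f is cs) (hat f is cs')
    hat-compatible f is cs cs' rs j with j ≟ opI f is
    ... | yes _ = compatible f _ _ (Pointwise-entries {β} is rs)
    ... | no _  = Pointwise-first (noNull f) rs j

  -- R ⊆ α puts the intermediate entries z⁽ⁱ⁾ into D⁽ⁱ⁾, so that they form a column.
  *-∘ᵣ : {R Q : Rel (Carrier A) a} → R ⇒ α → (R *) ∘ᵣ (Q *) ≐ (R ∘ᵣ Q) *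
  *-∘ᵣ {R} {Q} R⇒α = (λ {c} {c'} → merge {c} {c'}) , (λ {c} {c'} → split {c} {c'})
    where
    merge : (R *) ∘ᵣ (Q *) ⇒ (R ∘ᵣ Q) *
    merge (z , r , q) i = z ⟨ i ⟩ , r i , q i
    split : (R ∘ᵣ Q) * ⇒ (R *) ∘ᵣ (Q *)
    split {c} h = z , (λ i → proj₁ (proj₂ (h i))) , (λ i → proj₂ (proj₂ (h i)))
      where
      z : Col
      z i = proj₁ (h i) , trans (sym (R⇒α (proj₁ (proj₂ (h i))))) (proj₂ (c i))

  *-∘[] : ∀ k {R Q : Rel (Carrier A) a} → R ⇒ α → Q ⇒ α → ∘[ k ] (R *) (Q *) ≐ (∘[ k ] R Q) *
  *-∘[] zero          R⇒α Q⇒α = (λ r → r) , (λ r → r)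
  *-∘[] (suc zero)    R⇒α Q⇒α = (λ r → r) , (λ r → r)
  *-∘[] (suc (suc k)) {R} {Q} R⇒α Q⇒α =
    ≐-trans {P = ∘[ suc (suc k) ] (R *) (Q *)}
      (∘ᵣ-congʳ (*-∘[] (suc k) Q⇒α R⇒α)) (*-∘ᵣ {R} {∘[ suc k ] Q R} R⇒α)

  module WithSurjective (χ-surj : Surjective χ) where

    baseCol : Col
    baseCol i = χ-surj i

    setEntry : (i : Fin m) (x : Carrier A) → χ x ≡ i → Col
    setEntry i x χx≡i j with j ≟ i
    ... | yes j≡i = x , trans χx≡i (sym j≡i)
    ... | no _    = baseCol j

    setEntry-at : ∀ i x χx≡i → setEntry i x χx≡i ⟨ i ⟩ ≡ x
    setEntry-at i x χx≡i with i ≟ i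
    ... | yes _ = refl
    ... | no ≢ = ⊥-elim (≢ refl)

    setEntry-cong : ∀ i {x y} (χx≡i : χ x ≡ i) (χy≡i : χ y ≡ i) →
                    x ≡ y → setEntry i x χx≡i ≈C setEntry i y χy≡i
    setEntry-cong i _ _ x≡y j with j ≟ i
    ... | yes _ = x≡y
    ... | no _  = refl

    *-reflects-⇒ : {R Q : Rel (Carrier A) a} → Reflexive R → R ⇒ α →
                   (R *) ⇒ (Q *) → R ⇒ Q
    *-reflects-⇒ {R} {Q} reflR R⇒α R*⇒Q* {x} {y} r =
      subst₂ Q (setEntry-at (χ x) x refl) (setEntry-at (χ x) y (sym (R⇒α r)))
        (R*⇒Q* {c} {c'} r* (χ x))
      where
      c c' : Col
      c = setEntry (χ x) x refl
      c' = setEntry (χ x) y (sym (R⇒α r))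
      r* : (R *) c c'
      r* j with j ≟ χ x
      ... | yes _ = r
      ... | no _  = reflR

    *-reflects-≐ : {R Q : Rel (Carrier A) a} → Reflexive R → Reflexive Q → R ⇒ α → Q ⇒ α →
                   (R *) ≐ (Q *) → R ≐ Q
    *-reflects-≐ {R} {Q} reflR reflQ R⇒α Q⇒α (R*⇒Q* , Q*⇒R*) =
      *-reflects-⇒ {R} {Q} reflR R⇒α (λ {c} {c'} → R*⇒Q* {c} {c'})
      , *-reflects-⇒ {Q} {R} reflQ Q⇒α (λ {c} {c'} → Q*⇒R* {c} {c'})

    *-isOrderEmbedding : {β γ : Rel (Carrier A) a} → InInterval β → (β ⇒ γ) ⇔ ((β *) ⇒ (γ *))
    *-isOrderEmbedding ((isEqβ , _) , β⇒α) =
      mk⇔ *-mono (*-reflects-⇒ (IsEquivalence.refl isEqβ) β⇒α)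

    module Flat (θ : Rel Col a) (θ-con : IsCongruenceC θ) where

      private
        module θ = IsEquivalence (proj₁ θ-con)

        ≈C⇒θ : _≈C_ ⇒ θ
        ≈C⇒θ = proj₁ (proj₂ θ-con)

        d-compatible : ∀ cs cs' → Pointwise θ cs cs' → θ (dC cs) (dC cs')
        d-compatible = proj₁ (proj₂ (proj₂ θ-con))

        hat-compatible : ∀ f is cs cs' → Pointwise θ cs cs' → θ (hat f is cs) (hat f is cs')
        hat-compatible = proj₂ (proj₂ (proj₂ θ-con))

      EntryRel : Fin m → Rel (Carrier A) a
      EntryRel i x y = Σ Col λ p → Σ Col λ q → θ p q × p ⟨ i ⟩ ≡ x × q ⟨ i ⟩ ≡ y

      θ♭ : Rel (Carrier A) a
      θ♭ x y = EntryRel (χ x) x y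

      EntryRel-move : ∀ {i j x y} → i ≡ j → EntryRel i x y → EntryRel j x y
      EntryRel-move {x = x} {y} i≡j = subst (λ i → EntryRel i x y) i≡j

      onlyAt : Fin m → Col → Fin m → Col
      onlyAt i p j with j ≟ i
      ... | yes _ = p
      ... | no _  = baseCol

      localise : Fin m → Col → Col
      localise i p = dC (tabulate (onlyAt i p))

      localise-θ : ∀ i {p q} → θ p q → θ (localise i p) (localise i q)
      localise-θ i {p} {q} t = d-compatible _ _ (Pointwise.tabulate⁺ onlyAt-θ)
        where
        onlyAt-θ : ∀ j → θ (onlyAt i p j) (onlyAt i q j)
        onlyAt-θ j with j ≟ i
        ... | yes _ = t
        ... | no _  = θ.refl

      localise-≈C : ∀ i p → localise i p ≈C setEntry i (p ⟨ i ⟩) (proj₂ (p i))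
      localise-≈C i p j = trans (dC-tabulate _ j) (entry j)
        where
        entry : ∀ j → onlyAt i p j ⟨ j ⟩ ≡ setEntry i (p ⟨ i ⟩) (proj₂ (p i)) ⟨ j ⟩
        entry j with j ≟ i
        ... | yes refl = refl
        ... | no _     = refl

      localise-entry : ∀ i p → localise i p ⟨ i ⟩ ≡ p ⟨ i ⟩
      localise-entry i p = trans (localise-≈C i p i) (setEntry-at i _ _)

      localise-cong : ∀ i p q → p ⟨ i ⟩ ≡ q ⟨ i ⟩ → localise i p ≈C localise i q
      localise-cong i p q p≡q j =
        trans (localise-≈C i p j)
          (trans (setEntry-cong i _ _ p≡q j) (sym (localise-≈C i q j)))

      -- The middle columns q and p' agree only at entry i; localising at i
      -- makes them equal, so θ can be chained.
      EntryRel-trans : ∀ i {x y z} → EntryRel i x y → EntryRel i y z → EntryRel i x z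
      EntryRel-trans i (p , q , t , px , qy) (p' , q' , t' , p'y , q'z) =
        localise i p , localise i q' ,
        θ.trans (localise-θ i t)
          (θ.trans (≈C⇒θ (localise-cong i q p' (trans qy (sym p'y)))) (localise-θ i t')) ,
        trans (localise-entry i p) px , trans (localise-entry i q') q'z

      θ♭⇒α : θ♭ ⇒ α
      θ♭⇒α {x} (_ , q , _ , _ , qy) = sym (subst (λ v → χ v ≡ χ x) qy (proj₂ (q (χ x))))

      θ♭-isEquivalence : IsEquivalence θ♭
      θ♭-isEquivalence = record
        { refl  = λ {x} → let c = setEntry (χ x) x refl in
                  c , c , θ.refl , setEntry-at (χ x) x refl , setEntry-at (χ x) x refl
        ; sym   = λ r@(p , q , t , px , qy) → EntryRel-move (θ♭⇒α r) (q , p , θ.sym t , qy , px)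
        ; trans = λ r s → EntryRel-trans _ r (EntryRel-move (sym (θ♭⇒α r)) s)
        }

      Pointwise-θ♭-columns : ∀ {k} {xs ys : Vec (Carrier A) k} → Pointwise θ♭ xs ys →
                             Σ (Vec Col k) λ ps → Σ (Vec Col k) λ qs → Pointwise θ ps qs ×
                             zipWith _⟨_⟩ ps (map χ xs) ≡ xs × zipWith _⟨_⟩ qs (map χ xs) ≡ ys
      Pointwise-θ♭-columns [] = [] , [] , [] , refl , refl
      Pointwise-θ♭-columns ((p , q , t , px , qy) ∷ rs) =
        let ps , qs , ts , psxs , qsys = Pointwise-θ♭-columns rs in
        p ∷ ps , q ∷ qs , t ∷ ts , cong₂ _∷_ px psxs , cong₂ _∷_ qy qsys

      θ♭-compatible : ∀ f xs ys → Pointwise θ♭ xs ys → θ♭ (op A f xs) (op A f ys)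
      θ♭-compatible f xs ys rs =
        let ps , qs , ts , psxs , qsys = Pointwise-θ♭-columns rs
            is = map χ xs in
        EntryRel-move (sym (χ-hom f xs))
          (hat f is ps , hat f is qs , hat-compatible f is ps qs ts ,
           trans (hat-at f is ps) (cong (op A f) psxs) ,
           trans (hat-at f is qs) (cong (op A f) qsys))

      θ♭-inInterval : InInterval θ♭
      θ♭-inInterval = (θ♭-isEquivalence , θ♭-compatible) , θ♭⇒α

      θ⇒θ♭* : θ ⇒ θ♭ *
      θ⇒θ♭* {c} {c'} t i = EntryRel-move (sym (proj₂ (c i))) (c , c' , t , refl , refl)

      -- Taking witnesses (pᵢ , qᵢ) for each entry, d reassembles c and c'
      -- from the diagonals of the pᵢ and of the qᵢ.
      θ♭*⇒θ : θ♭ * ⇒ θ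
      θ♭*⇒θ {c} {c'} r =
        θ.trans (≈C⇒θ c≈dps)
          (θ.trans (d-compatible ps qs (Pointwise.tabulate⁺ ts)) (≈C⇒θ dqs≈c'))
        where
        witness : ∀ i → EntryRel i (c ⟨ i ⟩) (c' ⟨ i ⟩)
        witness i = EntryRel-move (proj₂ (c i)) (r i)
        ps qs : Vec Col m
        ps = tabulate λ i → proj₁ (witness i)
        qs = tabulate λ i → proj₁ (proj₂ (witness i))
        ts : ∀ i → θ (proj₁ (witness i)) (proj₁ (proj₂ (witness i)))
        ts i = proj₁ (proj₂ (proj₂ (witness i)))
        c≈dps : c ≈C dC ps
        c≈dps i = sym (trans (dC-tabulate _ i) (proj₁ (proj₂ (proj₂ (proj₂ (witness i))))))
        dqs≈c' : dC qs ≈C c'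
        dqs≈c' i = trans (dC-tabulate _ i) (proj₂ (proj₂ (proj₂ (proj₂ (witness i)))))

    *-onto : (θ : Rel Col a) → IsCongruenceC θ →
             Σ (Rel (Carrier A) a) λ β → InInterval β × (θ ≐ (β *))
    *-onto θ θ-con = θ♭ , θ♭-inInterval , θ⇒θ♭* , θ♭*⇒θ
      where open Flat θ θ-con

    *-preserves-join : {J : Set a} (βs : J → Rel (Carrier A) a) → (∀ j → InInterval (βs j)) →
                       (β : Rel (Carrier A) a) → IsJoinOf (IsCongruence A) βs β →
                       IsJoinOf IsCongruenceC (λ j → βs j *) (β *)
    *-preserves-join βs βs-in β (β-con , βs⇒β , β-least) =
      *-isCongruenceC β-con , (λ j {c} {c'} → *-mono {βs j} {β} (βs⇒β j) {c} {c'}) , least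
      where
      least : ∀ γ → IsCongruenceC γ → (∀ j → (βs j *) ⇒ γ) → (β *) ⇒ γ
      least γ γ-con βs*⇒γ {c} {c'} r with *-onto γ γ-con
      ... | δ , (δ-con , _) , (γ⇒δ* , δ*⇒γ) =
        δ*⇒γ (*-mono {β} {δ} (β-least δ δ-con βs⇒δ) {c} {c'} r)
        where
        βs⇒δ : ∀ j → βs j ⇒ δ
        βs⇒δ j = *-reflects-⇒ {βs j} {δ}
                   (IsEquivalence.refl (proj₁ (proj₁ (βs-in j)))) (proj₂ (βs-in j))
                   (λ {c} {c'} r → γ⇒δ* (βs*⇒γ j {c} {c'} r))

    *-permutable-⇔ : {β γ : Rel (Carrier A) a} → InInterval β → InInterval γ → ∀ k →
                     (∘[ k ] β γ ≐ ∘[ k ] γ β) ⇔ (∘[ k ] (β *) (γ *) ≐ ∘[ k ] (γ *) (β *))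
    *-permutable-⇔ {β} {γ} ((isEqβ , _) , β⇒α) ((isEqγ , _) , γ⇒α) k = mk⇔
      (λ perm → ≐-trans (*-∘[] k β⇒α γ⇒α) (≐-trans (*-cong perm) (≐-sym (*-∘[] k γ⇒α β⇒α))))
      (λ perm* → *-reflects-≐ (∘[]-refl k reflβ reflγ) (∘[]-refl k reflγ reflβ)
                   (∘[]-⇒ k trans-α β⇒α γ⇒α) (∘[]-⇒ k trans-α γ⇒α β⇒α)
                   (≐-trans (≐-sym (*-∘[] k β⇒α γ⇒α)) (≐-trans perm* (*-∘[] k γ⇒α β⇒α))))
      where
      reflβ : Reflexive β
      reflβ = IsEquivalence.refl isEqβ
      reflγ : Reflexive γ
      reflγ = IsEquivalence.refl isEqγ
      trans-α : Transitive α
      trans-α = trans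

corollary3p4 : ∀ {σ a : Level} (S : Signature σ) (noNull : NoNullary S)
    (m : ℕ) → 1 ≤ m →
    (opI : (f : Sym S) → Vec (Fin m) (arity S f) → Fin m)
    (A : Algebra S a) (χ : Carrier A → Fin m)
    (χ-hom : IsHom A (FinAlgebra m opI) χ)
    (χ-surj : Surjective χ) →
    let open Construction noNull A m opI χ χ-hom in
    -- (1) β ↦ β* is an isomorphism from I(0, α) onto Con(𝐂):
    --     it maps I(0, α) into Con(𝐂), ...
    ((β : Rel (Carrier A) a) → InInterval β → IsCongruenceC (β *))
    -- ... is an order embedding, ...
    × ((β γ : Rel (Carrier A) a) → InInterval β → InInterval γ →
         (β ⇒ γ) ⇔ ((β *) ⇒ (γ *)))
    -- ... and is onto Con(𝐂)
    × ((θ : Rel Col a) → IsCongruenceC θ →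
         Σ (Rel (Carrier A) a) (λ β → InInterval β × (θ ≐ (β *))))
    -- (2) intersections and joins of nonempty families
    × ((J : Set a) → J → (βs : J → Rel (Carrier A) a) → (∀ j → InInterval (βs j)) →
         ((⋂ βs) * ≐ ⋂ (λ j → βs j *))
         × ((β : Rel (Carrier A) a) → IsJoinOf (IsCongruence A) βs β →
              IsJoinOf IsCongruenceC (λ j → βs j *) (β *)))
    -- (2) k-permutability
    × ((β γ : Rel (Carrier A) a) → InInterval β → InInterval γ →
         (k : ℕ) → 2 ≤ k →
         ((∘[ k ] β γ ≐ ∘[ k ] γ β) ⇔ (∘[ k ] (β *) (γ *) ≐ ∘[ k ] (γ *) (β *))))
corollary3p4 S noNull m _ opI A χ χ-hom χ-surj =
    (λ β β-in → *-isCongruenceC (proj₁ β-in))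
  , (λ β γ β-in _ → *-isOrderEmbedding β-in)
  , *-onto
  , (λ J _ βs βs-in → *-⋂ βs , *-preserves-join βs βs-in)
  , (λ β γ β-in γ-in k _ → *-permutable-⇔ β-in γ-in k)
  where
  open Columns noNull A m opI χ χ-hom
  open WithSurjective χ-surj
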